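{- Let $G$ be a graph, and let $\widehat{G}$ be the graph obtained from $G$ by adding, for every vertex $v\in V(G)$, two new disjoint triangles $T_v$ and $T_v'$ (all new triangles pairwise disjoint and disjoint from $G$), together with an edge between $v$ and one vertex of $T_v$ and an edge between $v$ and one vertex of $T_v'$. Then $$\iota_{\rm g}(\widehat{G})=\iota_{\rm g}'(\widehat{G})=\frac{3}{7}\,n(\widehat{G}),$$ where $n(\widehat{G})$ is the order of $\widehat{G}$.
   Context: For a graph $G$ and $X\subseteq V(G)$, $N_G[X]$ denotes the set of vertices in $X$ or adjacent to a vertex of $X$. The isolation game on a finite graph $G$ is played by two players, Dominator and Staller, who alternately select vertices of $G$. If $X$ is the set of vertices selected so far, a vertex $x$ may be selected (is playable) only if $x$ dominates (i.e., equals or is adjacent to) some vertex belonging to a component of $G - N_G[X]$ with at least two vertices. The game ends when no playable vertex exists. Dominator aims to minimize the total number of selected vertices, Staller aims to maximize it. The game isolation number $\iota_{\rm g}(G)$ is the number of vertices selected when Dominator makes the first move and both play optimally; $\iota_{\rm g}'(G)$ is the same quantity when Staller makes the first move. -}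

module Defs where

open import Data.Nat using (ℕ; zero; suc; _*_)
open import Data.Fin using (Fin; toℕ; quotient; remainder)
open import Data.Fin.Subset using (Subset; _∈_; _∉_; _∪_; ⁅_⁆; ⊥)
open import Data.Product using (Σ; ∃; _×_; _,_)
open import Data.Sum using (_⊎_)
open import Relation.Binary.PropositionalEquality using (_≡_; _≢_)
open import Relation.Binary using (Decidable)
open import Relation.Nullary using (¬_)
open import Relation.Nullary.Decidable using (_×-dec_; _⊎-dec_)
open import Data.Bool using (Bool; true; false; _∨_; T)
open import Data.Bool.Properties using (T?)
open import Data.Unit using (tt)
open import Data.Sum using (inj₁; inj₂)
import Data.Nat as ℕ
import Data.Fin as F
import Relation.Binary.PropositionalEquality as ≡
open ≡ using (refl)

record Graph (n : ℕ) : Set₁ where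
  field
    Adj    : Fin n → Fin n → Set
    sym    : ∀ {u v} → Adj u v → Adj v u
    irrefl : ∀ {u} → ¬ Adj u u
    adj?   : Decidable Adj
open Graph public

order : ∀ {n} → Graph n → ℕ
order {n} _ = n

data Player : Set where
  Dominator Staller : Player

module _ {n : ℕ} (G : Graph n) where

  Dominates : Fin n → Fin n → Set
  Dominates x u = x ≡ u ⊎ Adj G x u

  InClosedNbhd : Subset n → Fin n → Set
  InClosedNbhd X u = ∃ λ x → x ∈ X × Dominates x u

  data Reach (X : Subset n) (u : Fin n) : Fin n → Set where
    here : ¬ InClosedNbhd X u → Reach X u u
    step : ∀ {v w} → Reach X u v → Adj G v w → ¬ InClosedNbhd X w → Reach X u w

  InBigComponent : Subset n → Fin n → Set
  InBigComponent X u = ¬ InClosedNbhd X u × (∃ λ w → w ≢ u × Reach X u w)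

  Playable : Subset n → Fin n → Set
  Playable X x = ∃ λ u → Dominates x u × InBigComponent X u

  -- AtMost p X k : from position X with p to move, Dominator has a strategy
  -- guaranteeing that at most k further vertices are selected.
  data AtMost : Player → Subset n → ℕ → Set where
    over  : ∀ {p X k} → (∀ x → ¬ Playable X x) → AtMost p X k
    dmove : ∀ {X k} x → Playable X x → AtMost Staller (X ∪ ⁅ x ⁆) k →
            AtMost Dominator X (suc k)
    smove : ∀ {X k} → (∀ x → Playable X x → AtMost Dominator (X ∪ ⁅ x ⁆) k) →
            AtMost Staller X (suc k)

  -- AtLeast p X k : from position X with p to move, Staller has a strategy
  -- guaranteeing that at least k further vertices are selected.
  data AtLeast : Player → Subset n → ℕ → Set where
    trivial : ∀ {p X} → AtLeast p X 0
    smove   : ∀ {X k} x → Playable X x → AtLeast Dominator (X ∪ ⁅ x ⁆) k →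
              AtLeast Staller X (suc k)
    dmove   : ∀ {X k} → (∃ λ x → Playable X x) →
              (∀ x → Playable X x → AtLeast Staller (X ∪ ⁅ x ⁆) k) →
              AtLeast Dominator X (suc k)

  GameValue : Player → ℕ → Set
  GameValue p k = AtMost p ⊥ k × AtLeast p ⊥ k

  IsGameIsolationNumber : ℕ → Set
  IsGameIsolationNumber = GameValue Dominator

  IsStallerStartGameIsolationNumber : ℕ → Set
  IsStallerStartGameIsolationNumber = GameValue Staller

-- Vertex set Fin (n * 7); vertex a corresponds to the pair
-- (quotient 7 a , remainder 7 a) = (v , i).  Position i = 0 is v itself,
-- positions 1,2,3 form the triangle T_v (1 attached to v), positions
-- 4,5,6 form the triangle T'_v (4 attached to v).

gadget₀ : ℕ → ℕ → Bool
gadget₀ 0 1 = true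
gadget₀ 0 4 = true
gadget₀ 1 2 = true
gadget₀ 2 3 = true
gadget₀ 1 3 = true
gadget₀ 4 5 = true
gadget₀ 5 6 = true
gadget₀ 4 6 = true
gadget₀ _ _ = false

gadget : ℕ → ℕ → Bool
gadget i j = gadget₀ i j ∨ gadget₀ j i

gadget-sym : ∀ i j → T (gadget i j) → T (gadget j i)
gadget-sym i j p with gadget₀ i j | gadget₀ j i
... | true  | true  = tt
... | true  | false = tt
... | false | true  = tt
... | false | false = p

gadget₀-irrefl : ∀ i → gadget₀ i i ≡ false
gadget₀-irrefl 0 = refl
gadget₀-irrefl 1 = refl
gadget₀-irrefl 2 = refl
gadget₀-irrefl 3 = refl
gadget₀-irrefl 4 = refl
gadget₀-irrefl 5 = refl
gadget₀-irrefl 6 = refl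
gadget₀-irrefl (suc (suc (suc (suc (suc (suc (suc _))))))) = refl

gadget-irrefl : ∀ i → ¬ T (gadget i i)
gadget-irrefl i p rewrite gadget₀-irrefl i = p

module _ {n : ℕ} (G : Graph n) where

  base : Fin (n * 7) → Fin n
  base a = quotient 7 a

  pos : Fin (n * 7) → ℕ
  pos a = toℕ (remainder {n} 7 a)

  HatAdj : Fin (n * 7) → Fin (n * 7) → Set
  HatAdj a b = (pos a ≡ 0 × pos b ≡ 0 × Adj G (base a) (base b))
             ⊎ (base a ≡ base b × T (gadget (pos a) (pos b)))

  private
    hsym : ∀ {a b} → HatAdj a b → HatAdj b a
    hsym (inj₁ (p , q , e)) = inj₁ (q , p , Graph.sym G e)
    hsym {a} {b} (inj₂ (e , g)) = inj₂ (≡.sym e , gadget-sym (pos a) (pos b) g)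

    hirr : ∀ {a} → ¬ HatAdj a a
    hirr (inj₁ (_ , _ , e)) = Graph.irrefl G e
    hirr {a} (inj₂ (_ , g)) = gadget-irrefl (pos a) g

    hdec : Decidable HatAdj
    hdec a b = ((pos a ℕ.≟ 0) ×-dec (pos b ℕ.≟ 0) ×-dec adj? G (base a) (base b))
               ⊎-dec ((base a F.≟ base b) ×-dec T? (gadget (pos a) (pos b)))

  hat : Graph (n * 7)
  hat = record { Adj = HatAdj ; sym = hsym ; irrefl = hirr ; adj? = hdec }

module Submission where

-- Ĝ consists of n gadgets with three parts each: the centre v and the triangles T_v and T'_v.
-- Every selected vertex hits one part, so the number of unhit parts, 3n at the start, drops
-- by at most one per move.
--
-- Dominator makes every move hit a new part.  He keeps each centre that still lies in a
-- nontrivial component free of hit triangles (otherwise the attachment vertex of such a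
-- triangle would be a playable vertex of a hit part).  A Staller move can spoil this only
-- in its own gadget, and Dominator repairs it by dominating that centre: he selects the
-- attachment vertex of an unhit triangle, or else the centre itself.
--
-- Staller keeps the game going while some part is unhit.  She keeps the centre of every
-- gadget with a hit triangle selected, so a gadget with an unhit part has an unhit triangle,
-- whose two far vertices form a playable edge.  A Dominator move can spoil this only in its
-- own gadget and leaves a triangle there unhit; Staller repairs it by selecting that centre.
--
-- Both games therefore last exactly 3n = (3/7) n(Ĝ) moves.

open import Defs hiding (sym)
open import Data.Bool using (T)
open import Data.Bool.Properties using (T?)
open import Data.Fin as Fin using (Fin; zero; suc; toℕ; combine; quotient; remainder)
open import Data.Fin.Patterns using (0F; 1F; 2F; 3F; 4F; 5F; 6F)
open import Data.Fin.Properties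
  using (any?; all?; ¬∀⟶∃¬; combine-surjective; combine-injective; remQuot-combine)
import Data.Fin.Properties as Finₚ
open import Data.Fin.Subset using (Subset; _∈_; _∉_; _∪_; ⁅_⁆; ⊥)
open import Data.Fin.Subset.Properties using (_∈?_; x∈p∪q⁺; x∈p∪q⁻; x∈⁅x⁆; x∈⁅y⁆⇒x≡y; ∉⊥)
open import Data.Nat using (ℕ; zero; suc; _≤_; _*_)
open import Data.Nat.Properties
  using (≤-reflexive; ≤-trans; ≤-pred; n≤1+n; 0≢1+n; suc-injective; m<n⇒n≢0; *-cancelˡ-≡)
open import Data.Nat.Tactic.RingSolver using (solve-∀)
open import Data.Product using (∃; _×_; _,_; proj₁; proj₂)
open import Data.Sum using (_⊎_; inj₁; inj₂)
open import Data.Unit using (tt)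
open import Function using (_∘_)
open import Level using (0ℓ)
open import Relation.Binary.PropositionalEquality
  using (_≡_; _≢_; refl; cong; cong₂; sym; trans; subst; subst₂)
open import Relation.Nullary using (¬_; Dec; yes; no; contradiction)
open import Relation.Nullary.Decidable
  using (_×-dec_; _⊎-dec_; _→-dec_; ¬?; from-yes; decidable-stable)
import Relation.Nullary.Decidable as Dec
open import Relation.Nullary.Negation using (¬∃⟶∀¬)
open import Relation.Unary using (Pred; Decidable)

count : ∀ {m} {P : Pred (Fin m) 0ℓ} → Decidable P → ℕ
count {zero}  P? = 0
count {suc m} P? with P? zero
... | yes _ = suc (count (P? ∘ suc))
... | no  _ = count (P? ∘ suc)

module _ {m : ℕ} {P Q : Pred (Fin (suc m)) 0ℓ} where

  ⊆-except-suc : ∀ {i₀} → (∀ i → i ≢ suc i₀ → P i → Q i) → ∀ i → i ≢ i₀ → P (suc i) → Q (suc i)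
  ⊆-except-suc P⇒Q i i≢i₀ = P⇒Q (suc i) (i≢i₀ ∘ Finₚ.suc-injective)

⊆-except⇒⊆ : ∀ {m} {P Q : Pred (Fin m) 0ℓ} {i₀} →
             (∀ i → i ≢ i₀ → P i → Q i) → (P i₀ → Q i₀) → ∀ i → P i → Q i
⊆-except⇒⊆ {i₀ = i₀} P⇒Q at-i₀ i with i Fin.≟ i₀
... | yes refl = at-i₀
... | no i≢i₀  = P⇒Q i i≢i₀

count-cong : ∀ {m} {P Q : Pred (Fin m) 0ℓ} (P? : Decidable P) (Q? : Decidable Q) →
             (∀ i → P i → Q i) → (∀ i → Q i → P i) → count P? ≡ count Q?
count-cong {zero}  P? Q? P⇒Q Q⇒P = refl
count-cong {suc m} P? Q? P⇒Q Q⇒P with P? zero | Q? zero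
... | yes _ | yes _ = cong suc (count-cong (P? ∘ suc) (Q? ∘ suc) (P⇒Q ∘ suc) (Q⇒P ∘ suc))
... | yes p | no ¬q = contradiction (P⇒Q zero p) ¬q
... | no ¬p | yes q = contradiction (Q⇒P zero q) ¬p
... | no _  | no _  = count-cong (P? ∘ suc) (Q? ∘ suc) (P⇒Q ∘ suc) (Q⇒P ∘ suc)

count-drop : ∀ {m} {P Q : Pred (Fin m) 0ℓ} (P? : Decidable P) (Q? : Decidable Q) {i₀ : Fin m} →
             (∀ i → Q i → P i) → (∀ i → i ≢ i₀ → P i → Q i) → P i₀ → ¬ Q i₀ →
             count P? ≡ suc (count Q?)
count-drop {suc m} P? Q? {zero} Q⇒P P⇒Q p ¬q with P? zero | Q? zero
... | yes _ | no _  = cong suc (count-cong (P? ∘ suc) (Q? ∘ suc) (λ i → P⇒Q (suc i) λ ()) (Q⇒P ∘ suc))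
... | no ¬p | _     = contradiction p ¬p
... | yes _ | yes q = contradiction q ¬q
count-drop {suc m} P? Q? {suc i₀} Q⇒P P⇒Q p ¬q with P? zero | Q? zero
... | yes _  | yes _  = cong suc (count-drop (P? ∘ suc) (Q? ∘ suc) (Q⇒P ∘ suc) (⊆-except-suc P⇒Q) p ¬q)
... | yes p₀ | no ¬q₀ = contradiction (P⇒Q zero (λ ()) p₀) ¬q₀
... | no ¬p₀ | yes q₀ = contradiction (Q⇒P zero q₀) ¬p₀
... | no _   | no _   = count-drop (P? ∘ suc) (Q? ∘ suc) (Q⇒P ∘ suc) (⊆-except-suc P⇒Q) p ¬q

count-≤ : ∀ {m} {P Q : Pred (Fin m) 0ℓ} (P? : Decidable P) (Q? : Decidable Q) {i₀ : Fin m} →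
          (∀ i → Q i → P i) → (∀ i → i ≢ i₀ → P i → Q i) → count P? ≤ suc (count Q?)
count-≤ P? Q? {i₀} Q⇒P P⇒Q with P? i₀ | Q? i₀
... | yes p | no ¬q = ≤-reflexive (count-drop P? Q? Q⇒P P⇒Q p ¬q)
... | _     | yes q =
  ≤-trans (≤-reflexive (count-cong P? Q? (⊆-except⇒⊆ P⇒Q λ _ → q) Q⇒P)) (n≤1+n _)
... | no ¬p | no _  =
  ≤-trans (≤-reflexive (count-cong P? Q? (⊆-except⇒⊆ P⇒Q λ p → contradiction p ¬p) Q⇒P)) (n≤1+n _)

count-all : ∀ {m} {P : Pred (Fin m) 0ℓ} (P? : Decidable P) → (∀ i → P i) → count P? ≡ m
count-all {zero}  P? all = refl
count-all {suc m} P? all with P? zero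
... | yes _ = cong suc (count-all (P? ∘ suc) (all ∘ suc))
... | no ¬p = contradiction (all zero) ¬p

count-witness : ∀ {m} {P : Pred (Fin m) 0ℓ} (P? : Decidable P) → count P? ≢ 0 → ∃ P
count-witness {zero}  P? c≢0 = contradiction refl c≢0
count-witness {suc m} P? c≢0 with P? zero
... | yes p = zero , p
... | no _  = let i , p = count-witness (P? ∘ suc) c≢0 in suc i , p

module Hits {N C : ℕ} (component : Fin N → Fin C) where

  Hit : Subset N → Fin C → Set
  Hit X c = ∃ λ x → x ∈ X × component x ≡ c

  hit? : ∀ X → Decidable (Hit X)
  hit? X c = any? λ x → (x ∈? X) ×-dec (component x Fin.≟ c)

  unhit : Subset N → ℕ
  unhit X = count (¬? ∘ hit? X)

  module _ {X : Subset N} {x : Fin N} where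

    hit-∪⁺ : ∀ {c} → Hit X c → Hit (X ∪ ⁅ x ⁆) c
    hit-∪⁺ (y , y∈X , refl) = y , x∈p∪q⁺ (inj₁ y∈X) , refl

    hit-∪⁻ : ∀ {c} → Hit (X ∪ ⁅ x ⁆) c → Hit X c ⊎ component x ≡ c
    hit-∪⁻ (y , y∈X′ , refl) with x∈p∪q⁻ X ⁅ x ⁆ y∈X′
    ... | inj₁ y∈X  = inj₁ (y , y∈X , refl)
    ... | inj₂ y∈⁅x⁆ = inj₂ (cong component (sym (x∈⁅y⁆⇒x≡y x y∈⁅x⁆)))

    hit-new : Hit (X ∪ ⁅ x ⁆) (component x)
    hit-new = x , x∈p∪q⁺ (inj₂ (x∈⁅x⁆ x)) , refl

    stays-unhit : ∀ c → c ≢ component x → ¬ Hit X c → ¬ Hit (X ∪ ⁅ x ⁆) c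
    stays-unhit c c≢x ¬hit hit′ with hit-∪⁻ hit′
    ... | inj₁ hit = ¬hit hit
    ... | inj₂ x≡c = c≢x (sym x≡c)

    unhit-fresh : ¬ Hit X (component x) → unhit X ≡ suc (unhit (X ∪ ⁅ x ⁆))
    unhit-fresh fresh = count-drop (¬? ∘ hit? X) (¬? ∘ hit? (X ∪ ⁅ x ⁆))
      (λ _ ¬hit → ¬hit ∘ hit-∪⁺) stays-unhit fresh (λ ¬hit → ¬hit hit-new)

    unhit-≤ : unhit X ≤ suc (unhit (X ∪ ⁅ x ⁆))
    unhit-≤ = count-≤ (¬? ∘ hit? X) (¬? ∘ hit? (X ∪ ⁅ x ⁆)) (λ _ ¬hit → ¬hit ∘ hit-∪⁺) stays-unhit

  no-hit-⊥ : ∀ {c} → ¬ Hit ⊥ c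
  no-hit-⊥ (_ , x∈⊥ , _) = ∉⊥ x∈⊥

  unhit-⊥ : unhit ⊥ ≡ C
  unhit-⊥ = count-all (¬? ∘ hit? ⊥) λ _ → no-hit-⊥

  unhit-witness : ∀ {X} → unhit X ≢ 0 → ∃ λ c → ¬ Hit X c
  unhit-witness {X} = count-witness (¬? ∘ hit? X)

module Isolation {m : ℕ} (Γ : Graph m) where

  dominated? : ∀ X → Decidable (InClosedNbhd Γ X)
  dominated? X u = any? λ x → (x ∈? X) ×-dec ((x Fin.≟ u) ⊎-dec adj? Γ x u)

  dominated-∪ : ∀ {X x u} → InClosedNbhd Γ X u → InClosedNbhd Γ (X ∪ ⁅ x ⁆) u
  dominated-∪ (y , y∈X , y-u) = y , x∈p∪q⁺ (inj₁ y∈X) , y-u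

  reach-∪⁻ : ∀ {X x u w} → Reach Γ (X ∪ ⁅ x ⁆) u w → Reach Γ X u w
  reach-∪⁻ (here ¬dom)            = here (¬dom ∘ dominated-∪)
  reach-∪⁻ (step reach u-w ¬dom) = step (reach-∪⁻ reach) u-w (¬dom ∘ dominated-∪)

  inBigComponent-∪⁻ : ∀ {X x u} → InBigComponent Γ (X ∪ ⁅ x ⁆) u → InBigComponent Γ X u
  inBigComponent-∪⁻ (¬dom , w , w≢u , reach) = ¬dom ∘ dominated-∪ , w , w≢u , reach-∪⁻ reach

  undominated-edge⇒inBigComponent : ∀ {X u w} → ¬ InClosedNbhd Γ X u → Adj Γ u w →
                                    ¬ InClosedNbhd Γ X w → InBigComponent Γ X u
  undominated-edge⇒inBigComponent ¬dom-u u-w ¬dom-w =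
    ¬dom-u , _ , (λ { refl → irrefl Γ u-w }) , step (here ¬dom-u) u-w ¬dom-w

  inBigComponent⇒undominated-neighbour : ∀ {X u} → InBigComponent Γ X u →
                                         ∃ λ w → Adj Γ u w × ¬ InClosedNbhd Γ X w
  inBigComponent⇒undominated-neighbour {X} {u} (_ , w , w≢u , reach) = first-step reach w≢u
    where
    first-step : ∀ {w} → Reach Γ X u w → w ≢ u → ∃ λ w → Adj Γ u w × ¬ InClosedNbhd Γ X w
    first-step (here _) w≢u = contradiction refl w≢u
    first-step (step {v} {w} reach v-w ¬dom-w) w≢u with v Fin.≟ u
    ... | yes refl = w , v-w , ¬dom-w
    ... | no v≢u   = first-step reach v≢u

  inBigComponent? : ∀ X → Decidable (InBigComponent Γ X)
  inBigComponent? X u =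
    Dec.map′ (λ (¬dom , w , u-w , ¬dom-w) → undominated-edge⇒inBigComponent ¬dom u-w ¬dom-w)
             (λ big → proj₁ big , inBigComponent⇒undominated-neighbour big)
             (¬? (dominated? X u) ×-dec any? λ w → adj? Γ u w ×-dec ¬? (dominated? X w))

  playable-self : ∀ {X u} → InBigComponent Γ X u → Playable Γ X u
  playable-self big = _ , inj₁ refl , big

  playable-adj : ∀ {X x u} → Adj Γ x u → InBigComponent Γ X u → Playable Γ X x
  playable-adj x-u big = _ , inj₂ x-u , big

  undominated⇒∉ : ∀ {X u} → ¬ InClosedNbhd Γ X u → u ∉ X
  undominated⇒∉ ¬dom u∈X = ¬dom (_ , u∈X , inj₁ refl)

  playable⇒∉ : ∀ {X x} → Playable Γ X x → x ∉ X
  playable⇒∉ (_ , x-u , ¬dom , _) x∈X = ¬dom (_ , x∈X , x-u)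

module PotentialGame {m : ℕ} (Γ : Graph m) (φ : Subset m → ℕ) where

  DropsByOne : Subset m → Fin m → Set
  DropsByOne X x = φ X ≡ suc (φ (X ∪ ⁅ x ⁆))

  DropsByAtMostOne : Subset m → Fin m → Set
  DropsByAtMostOne X x = φ X ≤ suc (φ (X ∪ ⁅ x ⁆))

  module Upper {DomInv StaInv : Pred (Subset m) 0ℓ}
    (dominator : ∀ {X} → DomInv X → (∀ x → ¬ Playable Γ X x) ⊎
                 ∃ λ x → Playable Γ X x × DropsByOne X x × StaInv (X ∪ ⁅ x ⁆))
    (staller : ∀ {X x} → StaInv X → Playable Γ X x → DropsByOne X x × DomInv (X ∪ ⁅ x ⁆))
    where

    atMost-dominator : ∀ {X} k → φ X ≡ k → DomInv X → AtMost Γ Dominator X k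
    atMost-staller   : ∀ {X} k → φ X ≡ k → StaInv X → AtMost Γ Staller X k

    atMost-dominator k φ≡k inv with dominator inv
    atMost-dominator k       φ≡k inv | inj₁ stuck = over stuck
    atMost-dominator zero    φ≡k inv | inj₂ (x , playable , drop , inv′) =
      contradiction (trans (sym φ≡k) drop) 0≢1+n
    atMost-dominator (suc k) φ≡k inv | inj₂ (x , playable , drop , inv′) =
      dmove x playable (atMost-staller k (suc-injective (trans (sym drop) φ≡k)) inv′)

    atMost-staller zero φ≡k inv =
      over λ x playable → 0≢1+n (trans (sym φ≡k) (proj₁ (staller inv playable)))
    atMost-staller (suc k) φ≡k inv = smove λ x playable →
      let drop , inv′ = staller inv playable
      in  atMost-dominator k (suc-injective (trans (sym drop) φ≡k)) inv′

  module Lower {DomInv StaInv : Pred (Subset m) 0ℓ}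
    (dominator-can-move : ∀ {X} → DomInv X → φ X ≢ 0 → ∃ (Playable Γ X))
    (dominator : ∀ {X x} → DomInv X → Playable Γ X x → DropsByAtMostOne X x × StaInv (X ∪ ⁅ x ⁆))
    (staller : ∀ {X} → StaInv X → φ X ≢ 0 →
               ∃ λ x → Playable Γ X x × DropsByAtMostOne X x × DomInv (X ∪ ⁅ x ⁆))
    where

    atLeast-dominator : ∀ {X} k → k ≤ φ X → DomInv X → AtLeast Γ Dominator X k
    atLeast-staller   : ∀ {X} k → k ≤ φ X → StaInv X → AtLeast Γ Staller X k

    atLeast-dominator zero    k≤φ inv = trivial
    atLeast-dominator (suc k) k≤φ inv =
      dmove (dominator-can-move inv (m<n⇒n≢0 k≤φ)) λ x playable →
        let drop , inv′ = dominator inv playable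
        in  atLeast-staller k (≤-pred (≤-trans k≤φ drop)) inv′

    atLeast-staller zero    k≤φ inv = trivial
    atLeast-staller (suc k) k≤φ inv =
      let x , playable , drop , inv′ = staller inv (m<n⇒n≢0 k≤φ)
      in  smove x playable (atLeast-dominator k (≤-pred (≤-trans k≤φ drop)) inv′)

GAdj : Fin 7 → Fin 7 → Set
GAdj i j = T (gadget (toℕ i) (toℕ j))

-- Positions in a gadget are numbered as in Defs; part 0 is the centre and part suc t, for
-- t : Fin 2, is the triangle T_v (t = 0) or T'_v (t = 1).
part : Fin 7 → Fin 3
part 0F = 0F
part 1F = 1F
part 2F = 1F
part 3F = 1F
part 4F = 2F
part 5F = 2F
part 6F = 2F

attachment far : Fin 2 → Fin 7
attachment 0F = 1F
attachment 1F = 4F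
far 0F = 2F
far 1F = 5F

part-attachment : ∀ t → part (attachment t) ≡ suc t
part-attachment 0F = refl
part-attachment 1F = refl

part-far : ∀ t → part (far t) ≡ suc t
part-far 0F = refl
part-far 1F = refl

private
  GAdj? : ∀ i j → Dec (GAdj i j)
  GAdj? i j = T? (gadget (toℕ i) (toℕ j))

part-clique : ∀ i j → part i ≡ part j → i ≡ j ⊎ GAdj i j
part-clique = from-yes (all? λ i → all? λ j → part i Fin.≟ part j →-dec (i Fin.≟ j ⊎-dec GAdj? i j))

part-centre : ∀ i → part i ≡ 0F → i ≡ 0F
part-centre = from-yes (all? λ i → part i Fin.≟ 0F →-dec i Fin.≟ 0F)

triangle-neighbour : ∀ i j → part i ≢ 0F → GAdj i j → part j ≡ part i ⊎ j ≡ 0F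
triangle-neighbour = from-yes (all? λ i → all? λ j →
  ¬? (part i Fin.≟ 0F) →-dec GAdj? i j →-dec (part j Fin.≟ part i ⊎-dec j Fin.≟ 0F))

other-triangle : ∀ (p : Fin 3) → ∃ λ (t : Fin 2) → suc t ≢ p
other-triangle 1F = 1F , λ ()
other-triangle 0F = 0F , λ ()
other-triangle 2F = 0F , λ ()

module Hat {n : ℕ} (G : Graph n) where

  Ĝ : Graph (n * 7)
  Ĝ = hat G

  open Isolation Ĝ

  pt : Fin n → Fin 7 → Fin (n * 7)
  pt = combine

  component : Fin (n * 7) → Fin (n * 3)
  component x = combine (quotient {n} 7 x) (part (remainder {n} 7 x))

  open Hits component

  module _ {v : Fin n} {i : Fin 7} where

    quotient-pt : quotient {n} 7 (pt v i) ≡ v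
    quotient-pt = cong proj₁ (remQuot-combine v i)

    remainder-pt : remainder {n} 7 (pt v i) ≡ i
    remainder-pt = cong proj₂ (remQuot-combine v i)

    component-pt : component (pt v i) ≡ combine v (part i)
    component-pt = cong₂ (λ w j → combine w (part j)) quotient-pt remainder-pt

  HitPart : Subset (n * 7) → Fin n → Fin 3 → Set
  HitPart X v p = Hit X (combine v p)

  module _ {X : Subset (n * 7)} {v : Fin n} where

    hitPart-intro : ∀ {i} → pt v i ∈ X → HitPart X v (part i)
    hitPart-intro pt∈X = _ , pt∈X , component-pt

    hitPart-elim : ∀ {p} → HitPart X v p → ∃ λ i → part i ≡ p × pt v i ∈ X
    hitPart-elim {p} (x , x∈X , x↦vp) with w , i , refl ← combine-surjective {n} {7} x
      with refl , part≡p ← combine-injective w (part i) v p (trans (sym component-pt) x↦vp)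
      = i , part≡p , x∈X

    fresh-pt : ∀ {i} → ¬ HitPart X v (part i) → ¬ Hit X (component (pt v i))
    fresh-pt ¬hit hit = ¬hit (subst (Hit X) component-pt hit)

    centre-unhit : pt v 0F ∉ X → ¬ HitPart X v 0F
    centre-unhit c∉X hit with i , part≡0 , pt∈X ← hitPart-elim hit
      rewrite part-centre i part≡0 = c∉X pt∈X

    hitPart-∪⁻ : ∀ {g j p} → HitPart (X ∪ ⁅ pt g j ⁆) v p → HitPart X v p ⊎ (g ≡ v × part j ≡ p)
    hitPart-∪⁻ {g} {j} {p} hit with hit-∪⁻ hit
    ... | inj₁ hit′ = inj₁ hit′
    ... | inj₂ g↦vp = inj₂ (combine-injective g (part j) v p (trans (sym component-pt) g↦vp))

    hitPart-∪-other : ∀ {g j p} → v ≢ g → HitPart (X ∪ ⁅ pt g j ⁆) v p → HitPart X v p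
    hitPart-∪-other v≢g hit with hitPart-∪⁻ hit
    ... | inj₁ hit′         = hit′
    ... | inj₂ (g≡v , _)    = contradiction (sym g≡v) v≢g

  gadget-adj : ∀ {v i j} → GAdj i j → Adj Ĝ (pt v i) (pt v j)
  gadget-adj {v} {i} {j} i-j = inj₂ (trans quotient-pt (sym quotient-pt) ,
    subst₂ (λ a b → T (gadget (toℕ a) (toℕ b))) (sym remainder-pt) (sym remainder-pt) i-j)

  triangle-adj-pt : ∀ {v w i j} → part i ≢ 0F → Adj Ĝ (pt v i) (pt w j) → v ≡ w × GAdj i j
  triangle-adj-pt i≠centre (inj₁ (i↦0 , _)) =
    contradiction (cong part (Finₚ.toℕ-injective (trans (cong toℕ (sym remainder-pt)) i↦0))) i≠centre
  triangle-adj-pt i≠centre (inj₂ (v≡w , i-j)) =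
    trans (sym quotient-pt) (trans v≡w quotient-pt) ,
    subst₂ (λ a b → T (gadget (toℕ a) (toℕ b))) remainder-pt remainder-pt i-j

  triangle-adj : ∀ {v i y} → part i ≢ 0F → Adj Ĝ (pt v i) y → ∃ λ j → y ≡ pt v j × GAdj i j
  triangle-adj {y = y} i≠centre i-y with w , j , refl ← combine-surjective {n} {7} y
    with refl , i-j ← triangle-adj-pt i≠centre i-y = j , refl , i-j

  module _ {X : Subset (n * 7)} {v : Fin n} where

    hitPart⇒dominated : ∀ {i} → HitPart X v (part i) → InClosedNbhd Ĝ X (pt v i)
    hitPart⇒dominated {i} hit with j , part-j≡part-i , pt∈X ← hitPart-elim hit
      with part-clique j i part-j≡part-i
    ... | inj₁ refl = _ , pt∈X , inj₁ refl
    ... | inj₂ j-i  = _ , pt∈X , inj₂ (gadget-adj j-i)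

    triangle-dominators : ∀ {i} → part i ≢ 0F → InClosedNbhd Ĝ X (pt v i) →
                          HitPart X v (part i) ⊎ (pt v 0F ∈ X × GAdj 0F i)
    triangle-dominators i≠centre (y , y∈X , inj₁ refl) = inj₁ (hitPart-intro y∈X)
    triangle-dominators {i} i≠centre (y , y∈X , inj₂ y-i)
      with j , refl , i-j ← triangle-adj i≠centre (Graph.sym Ĝ y-i)
      with triangle-neighbour i j i≠centre i-j
    ... | inj₁ part-j≡part-i = inj₁ (subst (HitPart X v) part-j≡part-i (hitPart-intro y∈X))
    ... | inj₂ refl          = inj₂ (y∈X , gadget-sym (toℕ i) 0 i-j)

    triangle-undominated : ∀ {i} → part i ≢ 0F → ¬ HitPart X v (part i) →
                           pt v 0F ∉ X ⊎ ¬ GAdj 0F i → ¬ InClosedNbhd Ĝ X (pt v i)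
    triangle-undominated i≠centre ¬hit centre-harmless dom with triangle-dominators i≠centre dom
    ... | inj₁ hit              = ¬hit hit
    ... | inj₂ (c∈X , centre-i) with centre-harmless
    ...   | inj₁ c∉X            = c∉X c∈X
    ...   | inj₂ ¬centre-i      = ¬centre-i centre-i

    far-edge-inBigComponent : ∀ t → ¬ HitPart X v (suc t) → InBigComponent Ĝ X (pt v (far t))
    far-edge-inBigComponent 0F ¬hit = undominated-edge⇒inBigComponent
      (triangle-undominated (λ ()) ¬hit (inj₂ λ ())) (gadget-adj {j = 3F} tt)
      (triangle-undominated (λ ()) ¬hit (inj₂ λ ()))
    far-edge-inBigComponent 1F ¬hit = undominated-edge⇒inBigComponent
      (triangle-undominated (λ ()) ¬hit (inj₂ λ ())) (gadget-adj {j = 6F} tt)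
      (triangle-undominated (λ ()) ¬hit (inj₂ λ ()))

    attachment-inBigComponent : ∀ t → pt v 0F ∉ X → ¬ HitPart X v (suc t) →
                                InBigComponent Ĝ X (pt v (attachment t))
    attachment-inBigComponent 0F c∉X ¬hit = undominated-edge⇒inBigComponent
      (triangle-undominated (λ ()) ¬hit (inj₁ c∉X)) (gadget-adj tt)
      (proj₁ (far-edge-inBigComponent 0F ¬hit))
    attachment-inBigComponent 1F c∉X ¬hit = undominated-edge⇒inBigComponent
      (triangle-undominated (λ ()) ¬hit (inj₁ c∉X)) (gadget-adj tt)
      (proj₁ (far-edge-inBigComponent 1F ¬hit))

    far-playable : ∀ t → ¬ HitPart X v (suc t) → Playable Ĝ X (pt v (far t))
    far-playable t ¬hit = playable-self (far-edge-inBigComponent t ¬hit)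

    attachment-playable : ∀ t → ¬ HitPart X v (suc t) → Playable Ĝ X (pt v (attachment t))
    attachment-playable 0F ¬hit = playable-adj (gadget-adj tt) (far-edge-inBigComponent 0F ¬hit)
    attachment-playable 1F ¬hit = playable-adj (gadget-adj tt) (far-edge-inBigComponent 1F ¬hit)

    centre-playable : ∀ t → pt v 0F ∉ X → ¬ HitPart X v (suc t) → Playable Ĝ X (pt v 0F)
    centre-playable 0F c∉X ¬hit = playable-adj (gadget-adj tt) (attachment-inBigComponent 0F c∉X ¬hit)
    centre-playable 1F c∉X ¬hit = playable-adj (gadget-adj tt) (attachment-inBigComponent 1F c∉X ¬hit)

  attachment-dominates-centre : ∀ {X v} t → InClosedNbhd Ĝ (X ∪ ⁅ pt v (attachment t) ⁆) (pt v 0F)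
  attachment-dominates-centre 0F = _ , x∈p∪q⁺ (inj₂ (x∈⁅x⁆ _)) , inj₂ (gadget-adj tt)
  attachment-dominates-centre 1F = _ , x∈p∪q⁺ (inj₂ (x∈⁅x⁆ _)) , inj₂ (gadget-adj tt)

  open PotentialGame Ĝ unhit

  Risky : Subset (n * 7) → Fin n → Set
  Risky X v = (∃ λ t → HitPart X v (suc t)) × InBigComponent Ĝ X (pt v 0F)

  risky? : ∀ X → Decidable (Risky X)
  risky? X v = any? (λ t → hit? X (combine v (suc t))) ×-dec inBigComponent? X (pt v 0F)

  NoRisk : Subset (n * 7) → Set
  NoRisk X = ∀ v → ¬ Risky X v

  AtMostOneRisky : Subset (n * 7) → Set
  AtMostOneRisky X = ∀ v w → Risky X v → Risky X w → v ≡ w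

  module _ {X : Subset (n * 7)} where

    risky-if-hit : ∀ {v p} → p ≢ 0F → HitPart X v p → InBigComponent Ĝ X (pt v 0F) → Risky X v
    risky-if-hit {p = 0F}    p≢0 = contradiction refl p≢0
    risky-if-hit {p = suc t} _ hit big = (t , hit) , big

    risky-∪⁻ : ∀ {g j v} → v ≢ g → Risky (X ∪ ⁅ pt g j ⁆) v → Risky X v
    risky-∪⁻ v≢g ((t , hit) , big) = (t , hitPart-∪-other v≢g hit) , inBigComponent-∪⁻ big

    near-hit-triangle : ∀ {g i u} → part i ≢ 0F → HitPart X g (part i) →
                        Dominates Ĝ (pt g i) u → ¬ InClosedNbhd Ĝ X u → u ≡ pt g 0F
    near-hit-triangle i≠centre hit (inj₁ refl) ¬dom = contradiction (hitPart⇒dominated hit) ¬dom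
    near-hit-triangle {g} {i} i≠centre hit (inj₂ i-u) ¬dom
      with j , refl , i-j ← triangle-adj i≠centre i-u
      with triangle-neighbour i j i≠centre i-j
    ... | inj₁ part-j≡part-i =
      contradiction (hitPart⇒dominated (subst (HitPart X g) (sym part-j≡part-i) hit)) ¬dom
    ... | inj₂ refl          = refl

    noRisk⇒fresh : ∀ {g i} → NoRisk X → Playable Ĝ X (pt g i) → ¬ HitPart X g (part i)
    noRisk⇒fresh {g} {i} noRisk playable@(u , i-u , big) hit with part i Fin.≟ 0F
    ... | no part≢0 with refl ← near-hit-triangle part≢0 hit i-u (proj₁ big) =
      noRisk g (risky-if-hit part≢0 hit big)
    ... | yes part≡0 with j , part-j≡0 , pt∈X ← hitPart-elim (subst (HitPart X g) part≡0 hit)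
      = playable⇒∉ playable (subst (λ k → pt g k ∈ X) j≡i pt∈X)
      where j≡i = trans (part-centre j part-j≡0) (sym (part-centre i part≡0))

    noRisk⇒stuck : NoRisk X → (∀ v t → HitPart X v (suc t)) → ∀ x → ¬ Playable Ĝ X x
    noRisk⇒stuck noRisk all-hit x (u , _ , big) with v , i , refl ← combine-surjective {n} {7} u
      with part i in part≡
    ... | 0F rewrite part-centre i part≡ = noRisk v ((0F , all-hit v 0F) , big)
    ... | suc t = proj₁ big (hitPart⇒dominated (subst (HitPart X v) (sym part≡) (all-hit v t)))

    noRisk-after-covering : ∀ {g j} → (∀ w → w ≢ g → ¬ Risky X w) →
                            InClosedNbhd Ĝ (X ∪ ⁅ pt g j ⁆) (pt g 0F) → NoRisk (X ∪ ⁅ pt g j ⁆)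
    noRisk-after-covering {g} others dom v risky with v Fin.≟ g
    ... | yes refl = proj₁ (proj₂ risky) dom
    ... | no v≢g   = others v v≢g (risky-∪⁻ v≢g risky)

    cover-centre : ∀ {g} → (∀ w → w ≢ g → ¬ Risky X w) →
                   Risky X g ⊎ (∃ λ t → ¬ HitPart X g (suc t)) →
                   ∃ λ x → Playable Ĝ X x × DropsByOne X x × NoRisk (X ∪ ⁅ x ⁆)
    cover-centre {g} others target with any? (λ t → ¬? (hit? X (combine g (suc t))))
    ... | yes (t , ¬hit) =
      pt g (attachment t) , attachment-playable t ¬hit ,
      unhit-fresh (fresh-pt (subst (λ p → ¬ HitPart X g p) (sym (part-attachment t)) ¬hit)) ,
      noRisk-after-covering others (attachment-dominates-centre t)
    ... | no all-hit with target
    ...   | inj₂ unhit     = contradiction unhit all-hit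
    ...   | inj₁ (_ , big) =
      pt g 0F , playable-self big ,
      unhit-fresh (fresh-pt (centre-unhit (undominated⇒∉ (proj₁ big)))) ,
      noRisk-after-covering others (_ , x∈p∪q⁺ (inj₂ (x∈⁅x⁆ _)) , inj₁ refl)

    dominator-restores-noRisk : AtMostOneRisky X → (∀ x → ¬ Playable Ĝ X x) ⊎
                                ∃ λ x → Playable Ĝ X x × DropsByOne X x × NoRisk (X ∪ ⁅ x ⁆)
    dominator-restores-noRisk atMostOne with any? (risky? X)
    ... | yes (g , risky) =
      inj₂ (cover-centre (λ w w≢g risky-w → w≢g (atMostOne w g risky-w risky)) (inj₁ risky))
    ... | no ¬risky with any? (λ v → any? λ t → ¬? (hit? X (combine v (suc t))))
    ...   | yes (g , unhit) = inj₂ (cover-centre (λ w _ → ¬∃⟶∀¬ ¬risky w) (inj₂ unhit))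
    ...   | no ¬unhit       = inj₁ (noRisk⇒stuck (¬∃⟶∀¬ ¬risky) λ v t →
                                      decidable-stable (hit? X _) λ ¬hit → ¬unhit (v , t , ¬hit))

    staller-move-from-noRisk : ∀ {x} → NoRisk X → Playable Ĝ X x →
                               DropsByOne X x × AtMostOneRisky (X ∪ ⁅ x ⁆)
    staller-move-from-noRisk {x} noRisk playable with g , j , refl ← combine-surjective {n} {7} x =
      unhit-fresh (fresh-pt (noRisk⇒fresh noRisk playable)) ,
      λ v w risky-v risky-w → trans (only-g risky-v) (sym (only-g risky-w))
      where
      only-g : ∀ {v} → Risky (X ∪ ⁅ pt g j ⁆) v → v ≡ g
      only-g {v} risky with v Fin.≟ g
      ... | yes v≡g = v≡g
      ... | no v≢g  = contradiction (risky-∪⁻ v≢g risky) (noRisk v)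

  Guarded : Subset (n * 7) → Fin n → Set
  Guarded X v = ∀ t → HitPart X v (suc t) → pt v 0F ∈ X

  guarded? : ∀ X → Decidable (Guarded X)
  guarded? X v = all? λ t → hit? X (combine v (suc t)) →-dec pt v 0F ∈? X

  AllGuarded : Subset (n * 7) → Set
  AllGuarded X = ∀ v → Guarded X v

  AlmostGuarded : Subset (n * 7) → Set
  AlmostGuarded X =
    ∀ v → Guarded X v ⊎ ((∃ λ t → ¬ HitPart X v (suc t)) × ∀ w → w ≢ v → Guarded X w)

  module _ {X : Subset (n * 7)} where

    guarded-∪ : ∀ {g j w} → w ≢ g → Guarded X w → Guarded (X ∪ ⁅ pt g j ⁆) w
    guarded-∪ w≢g guarded t hit = x∈p∪q⁺ (inj₁ (guarded t (hitPart-∪-other w≢g hit)))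

    guarded⇒unhit-triangle : ∀ {v p} → Guarded X v → ¬ HitPart X v p →
                             ∃ λ t → ¬ HitPart X v (suc t)
    guarded⇒unhit-triangle {p = 0F}    guarded ¬hit = 0F , ¬hit ∘ hitPart-intro ∘ guarded 0F
    guarded⇒unhit-triangle {p = suc t} guarded ¬hit = t , ¬hit

    allGuarded-after : ∀ {v j} → (∀ w → w ≢ v → Guarded X w) → pt v 0F ∈ X ∪ ⁅ pt v j ⁆ →
                       AllGuarded (X ∪ ⁅ pt v j ⁆)
    allGuarded-after {v} others c∈X′ w with w Fin.≟ v
    ... | yes refl = λ _ _ → c∈X′
    ... | no w≢v   = guarded-∪ w≢v (others w w≢v)

    guard-gadget : ∀ {v} → (∀ w → w ≢ v → Guarded X w) → (∃ λ t → ¬ HitPart X v (suc t)) →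
                   ∃ λ x → Playable Ĝ X x × DropsByAtMostOne X x × AllGuarded (X ∪ ⁅ x ⁆)
    guard-gadget {v} others (t , ¬hit) with pt v 0F ∈? X
    ... | no c∉X  = pt v 0F , centre-playable t c∉X ¬hit ,
                    ≤-reflexive (unhit-fresh (fresh-pt (centre-unhit c∉X))) ,
                    allGuarded-after others (x∈p∪q⁺ (inj₂ (x∈⁅x⁆ _)))
    ... | yes c∈X = pt v (far t) , far-playable t ¬hit ,
                    ≤-reflexive (unhit-fresh (fresh-pt (subst (λ p → ¬ HitPart X v p) (sym (part-far t))
                                                                ¬hit))) ,
                    allGuarded-after others (x∈p∪q⁺ (inj₁ c∈X))

    allGuarded-can-move : AllGuarded X → unhit X ≢ 0 → ∃ (Playable Ĝ X)
    allGuarded-can-move allGuarded unhit≢0 with c , ¬hit ← unhit-witness unhit≢0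
      with v , p , refl ← combine-surjective {n} {3} c
      with t , ¬hit-t ← guarded⇒unhit-triangle (allGuarded v) ¬hit = _ , far-playable t ¬hit-t

    dominator-move-from-allGuarded : ∀ {x} → AllGuarded X → Playable Ĝ X x →
                                     DropsByAtMostOne X x × AlmostGuarded (X ∪ ⁅ x ⁆)
    dominator-move-from-allGuarded {x} allGuarded _
      with g , j , refl ← combine-surjective {n} {7} x = unhit-≤ , almost
      where
      others : ∀ w → w ≢ g → Guarded (X ∪ ⁅ pt g j ⁆) w
      others w w≢g = guarded-∪ w≢g (allGuarded w)

      almost : AlmostGuarded (X ∪ ⁅ pt g j ⁆)
      almost v with v Fin.≟ g
      ... | no v≢g = inj₁ (others v v≢g)
      ... | yes refl with pt v 0F ∈? X ∪ ⁅ pt v j ⁆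
      ...   | yes c∈X′ = inj₁ λ _ _ → c∈X′
      ...   | no c∉X′ with t , t≢j ← other-triangle (part j) = inj₂ ((t , ¬hit) , others)
        where
        ¬hit : ¬ HitPart (X ∪ ⁅ pt v j ⁆) v (suc t)
        ¬hit hit′ with hitPart-∪⁻ hit′
        ... | inj₁ hit           = c∉X′ (x∈p∪q⁺ (inj₁ (allGuarded v t hit)))
        ... | inj₂ (_ , part≡t)  = t≢j (sym part≡t)

    staller-restores-allGuarded : AlmostGuarded X → unhit X ≢ 0 →
                                  ∃ λ x → Playable Ĝ X x × DropsByAtMostOne X x × AllGuarded (X ∪ ⁅ x ⁆)
    staller-restores-allGuarded almost unhit≢0 with all? (guarded? X)
    ... | yes allGuarded with c , ¬hit ← unhit-witness unhit≢0
      with v , p , refl ← combine-surjective {n} {3} c =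
      guard-gadget (λ w _ → allGuarded w) (guarded⇒unhit-triangle (allGuarded v) ¬hit)
    ... | no ¬allGuarded with v , ¬guarded ← ¬∀⟶∃¬ n (Guarded X) (guarded? X) ¬allGuarded
      with almost v
    ...   | inj₁ guarded          = contradiction guarded ¬guarded
    ...   | inj₂ (unhit , others) = guard-gadget others unhit

  module Up  = Upper dominator-restores-noRisk staller-move-from-noRisk
  module Low = Lower allGuarded-can-move dominator-move-from-allGuarded staller-restores-allGuarded

  game-values : IsGameIsolationNumber Ĝ (n * 3) × IsStallerStartGameIsolationNumber Ĝ (n * 3)
  game-values =
    (Up.atMost-dominator _ unhit-⊥ (λ v _ risky → contradiction risky (noRisk-⊥ v)) ,
     Low.atLeast-dominator _ (≤-reflexive (sym unhit-⊥)) allGuarded-⊥) ,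
    (Up.atMost-staller _ unhit-⊥ noRisk-⊥ ,
     Low.atLeast-staller _ (≤-reflexive (sym unhit-⊥)) (inj₁ ∘ allGuarded-⊥))
    where
    noRisk-⊥ : NoRisk ⊥
    noRisk-⊥ _ ((_ , hit) , _) = no-hit-⊥ hit

    allGuarded-⊥ : AllGuarded ⊥
    allGuarded-⊥ _ _ hit = contradiction hit no-hit-⊥

three-sevenths : ∀ n k → 7 * k ≡ 3 * (n * 7) → k ≡ n * 3
three-sevenths n k 7k≡ = *-cancelˡ-≡ k (n * 3) 7 (trans 7k≡ (reorder n))
  where
  reorder : ∀ n → 3 * (n * 7) ≡ 7 * (n * 3)
  reorder = solve-∀

proposition5p2 : ∀ {n : ℕ} (G : Graph n) (k : ℕ) → 7 * k ≡ 3 * order (hat G) →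
    IsGameIsolationNumber (hat G) k × IsStallerStartGameIsolationNumber (hat G) k
proposition5p2 {n} G k 7k≡ rewrite three-sevenths n k 7k≡ = Hat.game-values G
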